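{- (Realizability of regular abstract game forms.) Let $\mathcal L$ be one of the languages $\Phi_{\mathsf{CL}_{LI}},\Phi_{\mathsf{CL}_{AB}},\Phi_{\mathsf{CCSR}_{LI}},\Phi_{\mathsf{CCSR}_{AB}}$. For every regular abstract game form $(Ac_0,f)$ over $\mathcal L$ and every satisfiable elementary conjunction $\gamma$, there is a pointed concurrent game model $(M,s_0)$ that realizes $(Ac_0,f)$ and $\gamma$.
   Context: Fix a nonempty finite set $Ag$ of agents and a countable set $AP$ of atoms. A coalition is a subset of $Ag$. For a nonempty set $Ac$ of actions and coalition $A$, a joint action of $A$ is a function $A\to Ac$; $JA_A$ denotes the set of these and $JA=\bigcup_A JA_A$. A concurrent game model is $M=(St,Ac,av,out,L)$: $St$ nonempty set of states; $Ac$ nonempty set of actions; $av(s,A)\subseteq JA_A$ nonempty for each $s,A$, with $av(s,A)=\{\bigcup_{a\in A}\sigma_a\mid\sigma_a\in av(s,\{a\})\}$ for $A\neq\emptyset$ and $av(s,\emptyset)=\{\emptyset\}$; $out(s,\sigma)$ for $\sigma\in JA_A$ is $\emptyset$ if $\sigma\notin av(s,A)$, a singleton if $A=Ag$ and $\sigma\in av(s,Ag)$, and $\bigcup\{out(s,\sigma')\mid\sigma'\in av(s,Ag),\sigma\subseteq\sigma'\}$ if $A\ne Ag$ and $\sigma\in av(s,A)$; $L:St\to\mathcal P(AP)$. Let $\sigma_A\uplus\sigma_B=\sigma_A\cup\{(b,\beta)\in\sigma_B\mid b\in B\setminus A\}$. Languages: $\Phi_{\mathsf{CL}_{LI}}$: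 $\phi::=\top\mid\bot\mid p\mid\neg p\mid\phi\wedge\phi\mid\phi\vee\phi\mid[A]\phi$; $\Phi_{\mathsf{CL}_{AB}}$: same with $\langle A\rangle\phi$ instead of $[A]\phi$; $\Phi_{\mathsf{CCSR}_{LI}}$: same with $\mathsf C^d(A,\phi;B,\phi)$; $\Phi_{\mathsf{CCSR}_{AB}}$: same with $\mathsf C(A,\phi;B,\phi)$. Semantics: $M,s\models\langle A\rangle\phi$ iff some $\sigma_A\in av(s,A)$ has $M,t\models\phi$ for all $t\in out(s,\sigma_A)$; $[A]\phi$ means $\neg\langle A\rangle\neg\phi$; $M,s\models\mathsf C(A,\phi;B,\psi)$ iff some $\sigma_A\in av(s,A)$ has $M,t\models\phi$ for all $t\in out(s,\sigma_A)$ and some $\sigma_B\in av(s,B)$ has $M,t\models\psi$ for all $t\in out(s,\sigma_A\uplus\sigma_B)$; $\mathsf C^d(A,\phi;B,\psi)$ means $\neg\mathsf C(A,\neg\phi;B,\neg\psi)$; booleans standard. A set of formulas is satisfiable if all its members are true together at some pointed model. An elementary conjunction is a conjunction of literals (atoms or negated atoms). An abstract game form over $\mathcal L$ is a pair $(Ac_0,f)$ where $Ac_0$ is a nonempty set of actions and $f$ maps each $\sigma\in JA^0:=\bigcup_{A\subseteq Ag}JA^0_A$ (where $JA^0_A$ is the set of joint actions of $A$ with actions in $Ac_0$) to a subset of $\mathcal L$. It is regular if (1) $f(\sigma)$ is satisfiable for every $\sigma\in JA^0$, and (2) $f$ is monotonic: if $A\subseteq A'$, $\sigma_A\in JA^0_A$,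 $\sigma_{A'}\in JA^0_{A'}$ and $\sigma_A\subseteq\sigma_{A'}$, then $f(\sigma_A)\subseteq f(\sigma_{A'})$. A pointed model $(M,s_0)$, $M=(St,Ac,av,out,L)$, realizes $(Ac_0,f)$ and $\gamma$ if: $Ac_0\subseteq Ac$; $av(s_0,A)=JA^0_A$ for every coalition $A$; $M,s_0\models\gamma$; and for every coalition $A$ and $\sigma_A\in JA^0_A$, every $t\in out(s_0,\sigma_A)$ satisfies every formula in $f(\sigma_A)$. -}

module Defs where

open import Data.Nat using (ℕ)
open import Data.Fin using (Fin)
open import Data.Fin.Subset using (Subset; _∈_)
open import Data.Bool using (Bool; true; false)
open import Data.Maybe using (Maybe; just; nothing; _<∣>_)
import Data.Maybe as Maybe
open import Data.Vec using (Vec; lookup; zipWith; map)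
open import Data.Product using (Σ; ∃; _×_; _,_)
open import Data.Sum using (_⊎_)
open import Relation.Binary.PropositionalEquality using (_≡_)
open import Relation.Nullary using (¬_)
open import Function.Bundles using (_⇔_)

data Lang : Set where
  CL-LI CL-AB CCSR-LI CCSR-AB : Lang

module Game (n : ℕ) (AP : Set) where

  Agent : Set
  Agent = Fin n

  Coalition : Set
  Coalition = Subset n

  -- A joint action (of some coalition) with actions in Ac is a partial
  -- function Ag ⇀ Ac; its coalition is its domain.
  JointAction : Set → Set
  JointAction Ac = Vec (Maybe Ac) n

  _isJAof_ : {Ac : Set} → JointAction Ac → Coalition → Set
  σ isJAof A = ∀ (a : Agent) →
    (a ∈ A → ∃ λ x → lookup σ a ≡ just x) × (¬ (a ∈ A) → lookup σ a ≡ nothing)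

  _⊆J_ : {Ac : Set} → JointAction Ac → JointAction Ac → Set
  σ ⊆J σ' = ∀ a x → lookup σ a ≡ just x → lookup σ' a ≡ just x

  -- σ_A ⊎ σ_B = σ_A ∪ {(b,β) ∈ σ_B | b ∈ B \ A}
  _⊎J_ : {Ac : Set} → JointAction Ac → JointAction Ac → JointAction Ac
  σA ⊎J σB = zipWith _<∣>_ σA σB

  data Formula : Lang → Set where
    ⊤F ⊥F : ∀ {ℓ} → Formula ℓ
    atom natom : ∀ {ℓ} → AP → Formula ℓ
    _∧F_ _∨F_ : ∀ {ℓ} → Formula ℓ → Formula ℓ → Formula ℓ
    [_]_ : Coalition → Formula CL-LI → Formula CL-LI
    ⟨_⟩_ : Coalition → Formula CL-AB → Formula CL-AB
    Cd : Coalition → Formula CCSR-LI → Coalition → Formula CCSR-LI → Formula CCSR-LI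
    C : Coalition → Formula CCSR-AB → Coalition → Formula CCSR-AB → Formula CCSR-AB

  data ElemConj {ℓ : Lang} : Formula ℓ → Set where
    lit-pos : ∀ p → ElemConj (atom p)
    lit-neg : ∀ p → ElemConj (natom p)
    conj    : ∀ {φ ψ} → ElemConj φ → ElemConj ψ → ElemConj (φ ∧F ψ)

  -- Concurrent game models.
  -- av(s,{a}) is given by avAg s a; av(s,A) is then determined by the
  -- product condition (and av(s,∅) = {∅}).  out on full joint actions
  -- is given by a function outAg (the singleton), and out on all other
  -- joint actions is determined by the clauses in the definition.

  record Model : Set₁ where
    field
      St      : Set
      Ac      : Set
      avAg    : St → Agent → Ac → Set
      avAg≠∅  : ∀ s a → ∃ λ x → avAg s a x
      outAg   : St → Vec Ac n → St
      L       : St → AP → Set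

    Avail : St → JointAction Ac → Set
    Avail s σ = ∀ a x → lookup σ a ≡ just x → avAg s a x

    Out : St → JointAction Ac → St → Set
    Out s σ t = Avail s σ × ∃ λ (σ' : Vec Ac n) →
      (∀ a → avAg s a (lookup σ' a)) ×
      (∀ a x → lookup σ a ≡ just x → lookup σ' a ≡ x) ×
      outAg s σ' ≡ t

    Forces : St → Coalition → (St → Set) → Set
    Forces s A P = ∃ λ (σ : JointAction Ac) →
      σ isJAof A × Avail s σ × (∀ t → Out s σ t → P t)

    CSem : St → Coalition → (St → Set) → Coalition → (St → Set) → Set
    CSem s A P B Q = ∃ λ (σA : JointAction Ac) →
      σA isJAof A × Avail s σA × (∀ t → Out s σA t → P t) ×
      (∃ λ (σB : JointAction Ac) → σB isJAof B × Avail s σB ×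
         (∀ t → Out s (σA ⊎J σB) t → Q t))

    _⊨_ : ∀ {ℓ} → St → Formula ℓ → Set
    s ⊨ ⊤F = Data.Unit.⊤ where import Data.Unit
    s ⊨ ⊥F = Data.Empty.⊥ where import Data.Empty
    s ⊨ atom p = L s p
    s ⊨ natom p = ¬ L s p
    s ⊨ (φ ∧F ψ) = (s ⊨ φ) × (s ⊨ ψ)
    s ⊨ (φ ∨F ψ) = (s ⊨ φ) ⊎ (s ⊨ ψ)
    s ⊨ ([ A ] φ) = ¬ Forces s A (λ t → ¬ (t ⊨ φ))
    s ⊨ (⟨ A ⟩ φ) = Forces s A (λ t → t ⊨ φ)
    s ⊨ Cd A φ B ψ = ¬ CSem s A (λ t → ¬ (t ⊨ φ)) B (λ t → ¬ (t ⊨ ψ))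
    s ⊨ C A φ B ψ = CSem s A (λ t → t ⊨ φ) B (λ t → t ⊨ ψ)

  open Model public using (St; Ac)

  Satisfiable : ∀ {ℓ} → (Formula ℓ → Set) → Set₁
  Satisfiable Γ = ∃ λ (M : Model) → ∃ λ (s : Model.St M) →
    ∀ φ → Γ φ → Model._⊨_ M s φ

  record GameForm (ℓ : Lang) : Set₁ where
    field
      Ac₀    : Set
      Ac₀≠∅  : Ac₀
      f      : JointAction Ac₀ → Formula ℓ → Set

  Regular : ∀ {ℓ} → GameForm ℓ → Set₁
  Regular G =
    (∀ σ → Satisfiable (f σ)) ×
    (∀ σ σ' → σ ⊆J σ' → ∀ φ → f σ φ → f σ' φ)
    where open GameForm G

  -- (M, s₀) realizes (Ac₀, f) and γ.  Ac₀ ⊆ Ac is rendered by an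
  -- injective embedding e : Ac₀ → Ac.
  Realizes : ∀ {ℓ} → (M : Model) → Model.St M → GameForm ℓ → Formula ℓ → Set
  Realizes M s₀ G γ = ∃ λ (e : Ac₀ → Model.Ac M) →
      (∀ x y → e x ≡ e y → x ≡ y) ×
      (∀ (σ : JointAction (Model.Ac M)) →
         Model.Avail M s₀ σ ⇔ (∃ λ (σ₀ : JointAction Ac₀) → σ ≡ map (Maybe.map e) σ₀)) ×
      Model._⊨_ M s₀ γ ×
      (∀ (σ₀ : JointAction Ac₀) t → Model.Out M s₀ (map (Maybe.map e) σ₀) t →
         ∀ φ → f σ₀ φ → Model._⊨_ M t φ)
    where open GameForm G

-- The realizing model is an unravelling. At the root every agent may play
-- exactly the actions of Ac₀, and the root carries the valuation of a model of
-- γ. Regularity (1) gives, for every full profile π, a pointed model of f(π);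
-- the profile π leads from the root to a copy of it. Every outcome of a
-- partial σ_A is the successor of some full π ⊇ σ_A, and f(σ_A) ⊆ f(π) by
-- monotonicity (2). A copy satisfies the same formulas as the model it copies
-- because the two are related by an alternating bisimulation that matches
-- joint actions coalition by coalition, which is exactly what ⟨A⟩ and C need.
module Submission where

open import Data.Nat using (ℕ; _≤_)
open import Data.Fin using (Fin; zero; suc)
open import Data.Vec using (Vec; []; _∷_; lookup; map; tabulate)
open import Data.Vec.Properties using (lookup∘tabulate; lookup-map; lookup-zipWith; ∷-injectiveˡ; ∷-injectiveʳ)
open import Data.Vec.Relation.Binary.Pointwise.Extensional using (ext; Pointwise-≡⇒≡)
open import Data.Maybe using (Maybe; just; nothing; _<∣>_)
import Data.Maybe as Maybe
open import Data.Maybe.Relation.Binary.Pointwise using (Pointwise; just; nothing)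
import Data.Maybe.Relation.Binary.Pointwise as Pointwise
open import Data.Product using (Σ; ∃; _×_; _,_; proj₁; proj₂; -,_)
import Data.Sum as Sum
open import Data.Unit using (tt)
open import Function using (_∘_; flip; id)
open import Function.Bundles using (_⇔_; mk⇔; Equivalence)
import Function.Properties.Equivalence as ⇔
open import Function.Definitions using (Injective)
open import Relation.Binary.PropositionalEquality using (_≡_; refl; sym; trans; cong; cong₂; subst; subst₂; module ≡-Reasoning)

open import Defs

open Equivalence using (to; from)

tabulate-choice : ∀ {A : Set} {k} {P : Fin k → A → Set} →
  (∀ i → ∃ (P i)) → ∃ λ v → ∀ i → P i (lookup v i)
tabulate-choice {P = P} c =
  tabulate (proj₁ ∘ c) , λ i → subst (P i) (sym (lookup∘tabulate (proj₁ ∘ c) i)) (proj₂ (c i))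

map-preimage : ∀ {A B : Set} {k} (f : A → B) {P : B → Set} →
  (∀ b → P b → ∃ λ a → b ≡ f a) →
  (v : Vec B k) → (∀ i → P (lookup v i)) → ∃ λ w → v ≡ map f w
map-preimage f inv [] _ = [] , refl
map-preimage f inv (b ∷ v) p with inv b (p zero) | map-preimage f inv v (p ∘ suc)
... | a , refl | w , refl = a ∷ w , refl

map-injective : ∀ {A B : Set} {k} {f : A → B} → Injective _≡_ _≡_ f →
  Injective _≡_ _≡_ (map {n = k} f)
map-injective f-inj {[]} {[]} _ = refl
map-injective f-inj {a ∷ v} {a' ∷ v'} e =
  cong₂ _∷_ (f-inj (∷-injectiveˡ e)) (map-injective f-inj (∷-injectiveʳ e))

module _ {A B : Set} {R : A → B → Set} where

  pointwise-just : ∀ {m m'} → Pointwise R m m' → ∃ (λ x → m ≡ just x) → ∃ λ y → m' ≡ just y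
  pointwise-just (just _) _ = -, refl
  pointwise-just nothing (_ , ())

  pointwise-nothing : ∀ {m m'} → Pointwise R m m' → m ≡ nothing → m' ≡ nothing
  pointwise-nothing nothing _ = refl

  pointwise-<∣> : ∀ {m m' k k'} → Pointwise R m m' → Pointwise R k k' →
    Pointwise R (m <∣> k) (m' <∣> k')
  pointwise-<∣> (just r) _ = just r
  pointwise-<∣> nothing q = q

module Bisimulation (n : ℕ) (AP : Set) where
  open Game n AP

  PointwiseJA : {X Y : Set} → (Agent → X → Y → Set) → JointAction X → JointAction Y → Set
  PointwiseJA R σ τ = ∀ a → Pointwise (R a) (lookup σ a) (lookup τ a)

  isJAof-pointwise : ∀ {X Y} {R : Agent → X → Y → Set} σ τ →
    PointwiseJA R σ τ → ∀ {A} → σ isJAof A → τ isJAof A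
  isJAof-pointwise σ τ στ σ∈A a =
    pointwise-just (στ a) ∘ proj₁ (σ∈A a) , pointwise-nothing (στ a) ∘ proj₂ (σ∈A a)

  module _ {X Y : Set} {R : Agent → X → Y → Set} where

    isJAof-pointwise-⇔ : ∀ σ τ → PointwiseJA R σ τ → ∀ {A} → σ isJAof A ⇔ τ isJAof A
    isJAof-pointwise-⇔ σ τ στ =
      mk⇔ (isJAof-pointwise σ τ στ) (isJAof-pointwise τ σ (Pointwise.sym id ∘ στ))

    ⊎J-pointwise : ∀ σ σ' τ τ' → PointwiseJA R σ τ → PointwiseJA R σ' τ' →
      PointwiseJA R (σ ⊎J σ') (τ ⊎J τ')
    ⊎J-pointwise σ σ' τ τ' στ στ' a =
      subst₂ (Pointwise (R a))
        (sym (lookup-zipWith _<∣>_ a σ σ')) (sym (lookup-zipWith _<∣>_ a τ τ'))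
        (pointwise-<∣> (στ a) (στ' a))

  avail-⊎J : (M : Model) → ∀ {s} σ τ →
    Model.Avail M s σ → Model.Avail M s τ → Model.Avail M s (σ ⊎J τ)
  avail-⊎J M σ τ avσ avτ a x e
    with lookup σ a in σa | trans (sym (lookup-zipWith _<∣>_ a σ τ)) e
  ... | just y  | refl = avσ a y σa
  ... | nothing | τa   = avτ a x τa

  module _ (M N : Model) where
    private
      module M = Model M
      module N = Model N

    record IsBisimulation (Z : St M → St N → Set) : Set₁ where
      field
        Match        : St M → St N → JointAction (Ac M) → JointAction (Ac N) → Set
        atoms        : ∀ {s t} → Z s t → ∀ p → M.L s p ⇔ N.L t p
        match-isJAof : ∀ {s t} σ τ → Match s t σ τ → ∀ {A} → σ isJAof A ⇔ τ isJAof A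
        match-⊎J     : ∀ {s t} σ σ' τ τ' →
          Match s t σ τ → Match s t σ' τ' → Match s t (σ ⊎J σ') (τ ⊎J τ')
        forth        : ∀ {s t} → Z s t → ∀ σ → M.Avail s σ →
          ∃ λ τ → Match s t σ τ × N.Avail t τ
        back         : ∀ {s t} → Z s t → ∀ τ → N.Avail t τ →
          ∃ λ σ → Match s t σ τ × M.Avail s σ
        out-forth    : ∀ {s t s'} → Z s t → ∀ σ τ → Match s t σ τ → N.Avail t τ →
          M.Out s σ s' → ∃ λ t' → Z s' t' × N.Out t τ t'
        out-back     : ∀ {s t t'} → Z s t → ∀ σ τ → Match s t σ τ → M.Avail s σ →
          N.Out t τ t' → ∃ λ s' → Z s' t' × M.Out s σ s'

  module _ {M N : Model} {Z : St M → St N → Set} (b : IsBisimulation M N Z) where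
    private
      module M = Model M
      module N = Model N
    open IsBisimulation b

    outcomes-transfer : ∀ {s t} σ τ {P : St M → Set} {Q : St N → Set} →
      Z s t → Match s t σ τ → M.Avail s σ → (∀ {s' t'} → Z s' t' → P s' → Q t') →
      (∀ s' → M.Out s σ s' → P s') → ∀ t' → N.Out t τ t' → Q t'
    outcomes-transfer σ τ z m avσ PQ σ⇒P t' o =
      let s' , z' , o' = out-back z σ τ m avσ o in PQ z' (σ⇒P s' o')

    forces-transfer : ∀ {s t A} {P : St M → Set} {Q : St N → Set} →
      Z s t → (∀ {s' t'} → Z s' t' → P s' → Q t') → M.Forces s A P → N.Forces t A Q
    forces-transfer z PQ (σ , σ∈A , avσ , σ⇒P) =
      let τ , m , avτ = forth z σ avσ in
      τ , to (match-isJAof σ τ m) σ∈A , avτ , outcomes-transfer σ τ z m avσ PQ σ⇒P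

    csem-transfer : ∀ {s t A B} {P P' : St M → Set} {Q Q' : St N → Set} →
      Z s t → (∀ {s' t'} → Z s' t' → P s' → Q t') → (∀ {s' t'} → Z s' t' → P' s' → Q' t') →
      M.CSem s A P B P' → N.CSem t A Q B Q'
    csem-transfer z PQ PQ' (σ , σ∈A , avσ , σ⇒P , σ' , σ'∈B , avσ' , σσ'⇒P') =
      let τ , m , avτ = forth z σ avσ
          τ' , m' , avτ' = forth z σ' avσ'
      in τ , to (match-isJAof σ τ m) σ∈A , avτ , outcomes-transfer σ τ z m avσ PQ σ⇒P ,
         τ' , to (match-isJAof σ' τ' m') σ'∈B , avτ' ,
         outcomes-transfer (σ ⊎J σ') (τ ⊎J τ') z (match-⊎J σ σ' τ τ' m m')
           (avail-⊎J M σ σ' avσ avσ') PQ' σσ'⇒P'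

  module _ {M N : Model} {Z : St M → St N → Set} where
    private
      module M = Model M
      module N = Model N

    converse : IsBisimulation M N Z → IsBisimulation N M (flip Z)
    converse b = record
      { Match        = λ t s τ σ → Match s t σ τ
      ; atoms        = λ z p → ⇔.sym (atoms z p)
      ; match-isJAof = λ τ σ m → ⇔.sym (match-isJAof σ τ m)
      ; match-⊎J     = λ τ τ' σ σ' → match-⊎J σ σ' τ τ'
      ; forth        = back
      ; back         = forth
      ; out-forth    = λ z τ σ → out-back z σ τ
      ; out-back     = λ z τ σ → out-forth z σ τ
      }
      where open IsBisimulation b

    -- Only the forward direction is proved by recursion: the negative
    -- modalities [A] and Cᵈ are handled by transferring along the converse.
    ⊨-transfer : IsBisimulation M N Z → ∀ {ℓ} (φ : Formula ℓ) {s t} → Z s t → s M.⊨ φ → t N.⊨ φ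
    ⊨-transfer b ⊤F z _ = tt
    ⊨-transfer b ⊥F z ()
    ⊨-transfer b (atom p) z = to (IsBisimulation.atoms b z p)
    ⊨-transfer b (natom p) z ¬l = ¬l ∘ from (IsBisimulation.atoms b z p)
    ⊨-transfer b (φ ∧F ψ) z (sφ , sψ) = ⊨-transfer b φ z sφ , ⊨-transfer b ψ z sψ
    ⊨-transfer b (φ ∨F ψ) z = Sum.map (⊨-transfer b φ z) (⊨-transfer b ψ z)
    ⊨-transfer b ([ A ] φ) z ¬f f =
      ¬f (forces-transfer (converse b) z (λ z' ¬φ → ¬φ ∘ ⊨-transfer b φ z') f)
    ⊨-transfer b (⟨ A ⟩ φ) z = forces-transfer b z (⊨-transfer b φ)
    ⊨-transfer b (Cd A φ B ψ) z ¬c c =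
      ¬c (csem-transfer (converse b) z
            (λ z' ¬φ → ¬φ ∘ ⊨-transfer b φ z') (λ z' ¬ψ → ¬ψ ∘ ⊨-transfer b ψ z') c)
    ⊨-transfer b (C A φ B ψ) z = csem-transfer b z (⊨-transfer b φ) (⊨-transfer b ψ)

  elemConj-transfer : ∀ {M N : Model} {s t} {ℓ} {γ : Formula ℓ} → ElemConj γ →
    (∀ p → Model.L M s p ⇔ Model.L N t p) → Model._⊨_ M s γ → Model._⊨_ N t γ
  elemConj-transfer (lit-pos p) st = to (st p)
  elemConj-transfer (lit-neg p) st ¬l = ¬l ∘ from (st p)
  elemConj-transfer (conj γ δ) st (sγ , sδ) = elemConj-transfer γ st sγ , elemConj-transfer δ st sδ

module Unravelling (n : ℕ) (AP : Set) (Ac₀ : Set) (default₀ : Ac₀)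
  (M : Vec Ac₀ n → Game.Model n AP) (s : (π : Vec Ac₀ n) → Game.Model.St (M π))
  (L₀ : AP → Set) where
  open Game n AP
  open Bisimulation n AP

  Profile : Set
  Profile = Vec Ac₀ n

  -- An action of a copy is tagged with the profile π of its copy. Since
  -- profiles need not have decidable equality, tags are read relationally
  -- (Decodes) and a history denotes a state of a copy relationally (Denotes),
  -- so that the successor of a history can simply be the extended history.
  -- The action idle is available at every history, including those denoting
  -- no state, as it decodes to a fixed available action of the copy.
  data Action : Set where
    base  : Ac₀ → Action
    inner : (π : Profile) → Ac (M π) → Action
    idle  : Action

  data History : Set where
    root : History
    _▸_  : History → Vec Action n → History

  idle-choice : (π : Profile) → St (M π) → Agent → Ac (M π)
  idle-choice π u a = proj₁ (Model.avAg≠∅ (M π) u a)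

  data Decodes (π : Profile) (u : St (M π)) (a : Agent) : Action → Ac (M π) → Set where
    decode-inner : ∀ {y} → Decodes π u a (inner π y) y
    decode-idle  : Decodes π u a idle (idle-choice π u a)

  data Denotes (π : Profile) : History → St (M π) → Set where
    start : ∀ {v} → v ≡ map base π → Denotes π (root ▸ v) (s π)
    move  : ∀ {h u v zs} → Denotes π h u → (∀ a → Decodes π u a (lookup v a) (lookup zs a)) →
      Denotes π (h ▸ v) (Model.outAg (M π) u zs)

  AllDenoted : History → ((π : Profile) → St (M π) → Set) → Set
  AllDenoted h P = ∀ π u → Denotes π h u → P π u

  data IsBase : Action → Set where
    is-base : ∀ x → IsBase (base x)

  DecodesAvailable : Agent → Action → (π : Profile) → St (M π) → Set
  DecodesAvailable a x π u = ∃ λ y → Decodes π u a x y × Model.avAg (M π) u a y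

  available : History → Agent → Action → Set
  available root    a x = IsBase x
  available (h ▸ v) a x = AllDenoted (h ▸ v) (DecodesAvailable a x)

  available-nonempty : ∀ h a → ∃ (available h a)
  available-nonempty root a = base default₀ , is-base default₀
  available-nonempty (h ▸ v) a =
    idle , λ π u _ → idle-choice π u a , decode-idle , proj₂ (Model.avAg≠∅ (M π) u a)

  label : History → AP → Set
  label root    p = L₀ p
  label (h ▸ v) p = AllDenoted (h ▸ v) (λ π u → Model.L (M π) u p)

  N : Model
  N = record
    { St = History ; Ac = Action ; avAg = available ; avAg≠∅ = available-nonempty
    ; outAg = _▸_ ; L = label }

  module N = Model N

  base-injective : Injective _≡_ _≡_ base
  base-injective refl = refl

  decodes-functional : ∀ {π u a x y y'} → Decodes π u a x y → Decodes π u a x y' → y ≡ y'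
  decodes-functional decode-inner decode-inner = refl
  decodes-functional decode-idle  decode-idle  = refl

  denotes-unique : ∀ {π π' h u u'} → Denotes π h u → Denotes π' h u' →
    _≡_ {A = Σ Profile (St ∘ M)} (π , u) (π' , u')
  denotes-unique (start refl) (start e) with map-injective base-injective e
  ... | refl = refl
  denotes-unique (start _) (move () _)
  denotes-unique (move () _) (start _)
  denotes-unique {π} (move d dec) (move d' dec') with denotes-unique d d'
  ... | refl = cong (λ zs → π , Model.outAg (M π) _ zs)
                    (Pointwise-≡⇒≡ (ext λ a → decodes-functional (dec a) (dec' a)))

  allDenoted-⇔ : ∀ {π h u P} → Denotes π h u → AllDenoted h P ⇔ P π u
  allDenoted-⇔ {P = P} d = mk⇔ (λ all → all _ _ d) at-all
    where
    at-all : P _ _ → AllDenoted _ P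
    at-all Pu π' u' d' with denotes-unique d d'
    ... | refl = Pu

  available-denoted : ∀ {π h u a x} → Denotes π h u → available h a x ⇔ DecodesAvailable a x π u
  available-denoted d@(start _)  = allDenoted-⇔ d
  available-denoted d@(move _ _) = allDenoted-⇔ d

  label-denoted : ∀ {π h u} → Denotes π h u → ∀ p → label h p ⇔ Model.L (M π) u p
  label-denoted d@(start _)  p = allDenoted-⇔ d
  label-denoted d@(move _ _) p = allDenoted-⇔ d

  Match : (π : Profile) → St (M π) → JointAction Action → JointAction (Ac (M π)) → Set
  Match π u = PointwiseJA (Decodes π u)

  module _ {π : Profile} {h : History} {u : St (M π)} (d : Denotes π h u) where
    private
      module Mπ = Model (M π)

    decode-available : ∀ ν → N.Avail h ν → ∃ λ α → Match π u ν α × Mπ.Avail u α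
    decode-available ν avν =
      let α , dec = tabulate-choice (λ a → decode-at (lookup ν a) (avν a))
      in α , proj₁ ∘ dec , λ a → proj₂ (dec a)
      where
      decode-at : ∀ {a} m → (∀ x → m ≡ just x → available h a x) →
        ∃ λ m' → Pointwise (Decodes π u a) m m' × (∀ y → m' ≡ just y → Mπ.avAg u a y)
      decode-at nothing  _  = nothing , nothing , λ _ ()
      decode-at (just x) av =
        let y , dec , avy = to (available-denoted d) (av x refl)
        in just y , just dec , λ { _ refl → avy }

    encode-available : ∀ α → Mπ.Avail u α → ∃ λ ν → Match π u ν α × N.Avail h ν
    encode-available α avα =
      let ν , enc = tabulate-choice (λ a → encode-at (lookup α a) (avα a))
      in ν , proj₁ ∘ enc , λ a → proj₂ (enc a)
      where
      encode-at : ∀ {a} m' → (∀ y → m' ≡ just y → Mπ.avAg u a y) →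
        ∃ λ m → Pointwise (Decodes π u a) m m' × (∀ x → m ≡ just x → available h a x)
      encode-at nothing  _  = nothing , nothing , λ _ ()
      encode-at (just y) av =
        just (inner π y) , just decode-inner ,
        λ { _ refl → from (available-denoted d) (y , decode-inner , av y refl) }

    decoded-completion : ∀ {a m m' x₀ y₀} → Pointwise (Decodes π u a) m m' →
      (∀ x → m ≡ just x → x₀ ≡ x) → Decodes π u a x₀ y₀ → ∀ y → m' ≡ just y → y₀ ≡ y
    decoded-completion (just dec) x₀∈m dec₀ _ refl =
      decodes-functional (subst (λ x → Decodes π u _ x _) (x₀∈m _ refl) dec₀) dec

    encoded-completion : ∀ {a m m' y₀} → Pointwise (Decodes π u a) m m' →
      (∀ y → m' ≡ just y → y₀ ≡ y) → ∃ λ x → Decodes π u a x y₀ × (∀ x' → m ≡ just x' → x ≡ x')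
    encoded-completion (just {x} dec) y₀∈m' =
      x , subst (Decodes π u _ x) (sym (y₀∈m' _ refl)) dec , λ { _ refl → refl }
    encoded-completion nothing _ = inner π _ , decode-inner , λ _ ()

    decode-outcome : ∀ {t} ν α → Match π u ν α → Mπ.Avail u α → N.Out h ν t →
      ∃ λ u' → Denotes π t u' × Mπ.Out u α u'
    decode-outcome ν α m avα (_ , v , avv , v⊇ν , refl) =
      let zs , dec = tabulate-choice (λ a → to (available-denoted d) (avv a))
      in Mπ.outAg u zs , move d (proj₁ ∘ dec) ,
         avα , zs , (λ a → proj₂ (dec a)) ,
         (λ a → decoded-completion (m a) (v⊇ν a) (proj₁ (dec a))) , refl

    encode-outcome : ∀ {u'} ν α → Match π u ν α → N.Avail h ν → Mπ.Out u α u' →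
      ∃ λ t → Denotes π t u' × N.Out h ν t
    encode-outcome ν α m avν (_ , zs , avzs , zs⊇α , refl) =
      let v , enc = tabulate-choice (λ a → encoded-completion (m a) (zs⊇α a))
      in h ▸ v , move d (proj₁ ∘ enc) ,
         avν , v , (λ a → from (available-denoted d) (lookup zs a , proj₁ (enc a) , avzs a)) ,
         (λ a → proj₂ (enc a)) , refl

  denotes-bisimulation : (π : Profile) → IsBisimulation N (M π) (λ h u → Denotes π h u)
  denotes-bisimulation π = record
    { Match        = λ _ → Match π
    ; atoms        = label-denoted
    ; match-isJAof = λ {t = u} → isJAof-pointwise-⇔ {R = Decodes π u}
    ; match-⊎J     = λ {t = u} → ⊎J-pointwise {R = Decodes π u}
    ; forth        = λ d → decode-available d
    ; back         = λ d → encode-available d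
    ; out-forth    = λ d → decode-outcome d
    ; out-back     = λ d → encode-outcome d
    }

  ⊨-denoted : ∀ {π h u} {ℓ} (φ : Formula ℓ) → Denotes π h u → Model._⊨_ (M π) u φ → h N.⊨ φ
  ⊨-denoted φ d = ⊨-transfer (converse (denotes-bisimulation _)) φ d

  root-available : ∀ ν → N.Avail root ν ⇔ (∃ λ ν₀ → ν ≡ map (Maybe.map base) ν₀)
  root-available ν = mk⇔ (map-preimage (Maybe.map base) unbase ν) based
    where
    unbase : ∀ m → (∀ x → m ≡ just x → IsBase x) → ∃ λ m₀ → m ≡ Maybe.map base m₀
    unbase nothing  _ = nothing , refl
    unbase (just x) b with b x refl
    ... | is-base x₀ = just x₀ , refl
    mapped-base : ∀ m₀ x → Maybe.map base m₀ ≡ just x → IsBase x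
    mapped-base (just x₀) _ refl = is-base x₀
    based : (∃ λ ν₀ → ν ≡ map (Maybe.map base) ν₀) → N.Avail root ν
    based (ν₀ , refl) a x e = mapped-base (lookup ν₀ a) x (trans (sym (lookup-map a _ ν₀)) e)

  root-outcome : ∀ {t} ν₀ → N.Out root (map (Maybe.map base) ν₀) t →
    ∃ λ π → ν₀ ⊆J map just π × Denotes π t (s π)
  root-outcome ν₀ (_ , v , avv , v⊇ν , refl)
    with map-preimage base {IsBase} (λ { _ (is-base x) → x , refl }) v avv
  ... | π , refl = π , extends , start refl
    where
    extends : ν₀ ⊆J map just π
    extends a x e = begin
      lookup (map just π) a  ≡⟨ lookup-map a just π ⟩
      just (lookup π a)      ≡⟨ cong just (base-injective (begin
        base (lookup π a)       ≡⟨ lookup-map a base π ⟨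
        lookup (map base π) a   ≡⟨ v⊇ν a (base x) (trans (lookup-map a _ ν₀) (cong (Maybe.map base) e)) ⟩
        base x                  ∎)) ⟩
      just x                 ∎
      where open ≡-Reasoning

mainTheorem5 : (n : ℕ) → 1 ≤ n →
    (AP : Set) → (ι : AP → ℕ) → Injective _≡_ _≡_ ι →
    (ℓ : Lang) → (G : Game.GameForm n AP ℓ) → Game.Regular n AP G →
    (γ : Game.Formula n AP ℓ) → Game.ElemConj n AP γ →
    Game.Satisfiable n AP (λ φ → φ ≡ γ) →
    ∃ λ (M : Game.Model n AP) → ∃ λ (s₀ : Game.Model.St M) →
    Game.Realizes n AP M s₀ G γ
mainTheorem5 n _ AP _ _ ℓ G (sat , mono) γ γ-elem (Mγ , sγ , sγ⊨γ) =
  N , root , base , (λ _ _ → base-injective) , root-available ,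
  Bisimulation.elemConj-transfer n AP γ-elem (λ _ → ⇔.refl) (sγ⊨γ γ refl) ,
  λ ν₀ t o φ φ∈f →
    let π , ν₀⊆π , d = root-outcome ν₀ o
    in ⊨-denoted φ d (proj₂ (proj₂ (sat (map just π))) φ (mono ν₀ (map just π) ν₀⊆π φ φ∈f))
  where
  open Game.GameForm G
  open Unravelling n AP Ac₀ Ac₀≠∅
    (λ π → proj₁ (sat (map just π))) (λ π → proj₁ (proj₂ (sat (map just π))))
    (Game.Model.L Mγ sγ)
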